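{- Let $G=\langle V,E,r\rangle$ be a rooted directed graph with $n(G)$ nodes and let $A,B$ be two edge-disjoint arborescences of $G$. Write $A=\{a_1,\dots,a_{n(G)-1}\}$ ordered by increasing preorder number (in $A$) of their heads, and let $b_i$ be the unique edge of $B$ with the same head as $a_i$. For $i\in\{1,\dots,n(G)-1\}$ let $G_i$ be obtained from $G$ by contracting $a_1,\dots,a_{i-1}$ and removing $a_i$. Then $F(G_i)\subseteq\{b_i,b_{i+1},\dots,b_{n(G)-1}\}$.
   Context: Parallel edges are allowed, no loops. An arborescence of a rooted graph is a set of (number of nodes $-1$) edges such that every node is reachable from the root using only them. $F(H)$ denotes the set of forced edges of $H$, i.e. edges belonging to every arborescence of $H$. Contracting an edge $(u,v)$ deletes $v$ and all edges entering $v$, and changes the tail of every edge leaving $v$ to $u$ (edges keep their identity); contracting $a_1,\dots,a_{i-1}$ in order merges their heads into $r$. In the paper $G$ is additionally trimmed and $A,B$ come from a specific construction. -}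

module Defs where

open import Data.Nat using (ℕ; zero; suc; _<_)
open import Data.Fin using (Fin; toℕ; _≟_)
open import Data.Fin.Subset using (Subset; _∈_; _∉_; _⊆_; ∣_∣; ⊤; _-_)
open import Data.Bool using (Bool; true; false; if_then_else_; _∧_; not)
open import Data.Vec using (tabulate; lookup)
open import Data.List using (List; take; foldl)
import Data.List as L
open import Data.Product using (_×_; Σ; ∃; ∃-syntax)
open import Data.Sum using (_⊎_)
open import Relation.Nullary.Decidable using (⌊_⌋)
open import Relation.Binary.PropositionalEquality using (_≡_; _≢_)

-- A rooted directed graph over a fixed universe of node names Fin n and
-- edge names Fin m.  'nodes' / 'edges' say which names are currently present
-- (contraction / deletion remove names but keep edge identities).
record RGraph (n m : ℕ) : Set where
  field
    nodes : Subset n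
    edges : Subset m
    tl    : Fin m → Fin n
    hd    : Fin m → Fin n
    root  : Fin n
open RGraph public

data Reach {n m : ℕ} (tl hd : Fin m → Fin n) (T : Subset m) (x : Fin n)
       : Fin n → Set where
  here : Reach tl hd T x x
  step : ∀ {y e} → Reach tl hd T x y → e ∈ T → tl e ≡ y → Reach tl hd T x (hd e)

Arborescence : ∀ {n m} → RGraph n m → Subset m → Set
Arborescence H T =
  T ⊆ edges H × suc ∣ T ∣ ≡ ∣ nodes H ∣ ×
  (∀ v → v ∈ nodes H → Reach (tl H) (hd H) T (root H) v)

Forced : ∀ {n m} → RGraph n m → Fin m → Set
Forced H e = e ∈ edges H × (∀ T → Arborescence H T → e ∈ T)

contract : ∀ {n m} → RGraph n m → Fin m → RGraph n m
contract H e = record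
  { nodes = nodes H - v
  ; edges = tabulate (λ f → lookup (edges H) f ∧ not ⌊ hd H f ≟ v ⌋)
  ; tl    = λ f → if ⌊ tl H f ≟ v ⌋ then u else tl H f
  ; hd    = hd H
  ; root  = root H
  }
  where
    u = tl H e
    v = hd H e

deleteEdge : ∀ {n m} → RGraph n m → Fin m → RGraph n m
deleteEdge H e = record
  { nodes = nodes H ; edges = edges H - e ; tl = tl H ; hd = hd H ; root = root H }

contractAll : ∀ {n m} → RGraph n m → List (Fin m) → RGraph n m
contractAll = foldl contract

fullGraph : ∀ {n m} → (tl hd : Fin m → Fin n) → Fin n → RGraph n m
fullGraph tl hd r = record { nodes = ⊤ ; edges = ⊤ ; tl = tl ; hd = hd ; root = r }

-- G_i (0-based index i): contract a_0,…,a_{i-1} in order, then remove a_i.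
Gi : ∀ {n m k} → RGraph n m → (Fin k → Fin m) → Fin k → RGraph n m
Gi G a i = deleteEdge (contractAll G (take (toℕ i) (L.tabulate a))) (a i)

prevNode : ∀ {n m k} → Fin n → (Fin m → Fin n) → (Fin (suc k) → Fin m)
           → Fin (suc k) → Fin n
prevNode r hd a Fin.zero = r
prevNode r hd a (Fin.suc i) = hd (a (Data.Fin.inject₁ i))

-- a enumerates the edges of the arborescence A (of the graph with tail/head
-- maps tl, hd and root r) by increasing preorder number of their heads:
-- a is a bijection onto A, and the node sequence r, hd(a 0), hd(a 1), …
-- is a depth-first preorder of A, i.e. the parent of each next node is an
-- ancestor-or-self (in A) of the previous node in the sequence.
IsPreorderEnum : ∀ {n m k} → (tl hd : Fin m → Fin n) → Fin n → Subset m
                 → (Fin k → Fin m) → Set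
IsPreorderEnum {k = zero} tl hd r A a =
  ∀ e → e ∉ A
IsPreorderEnum {k = suc k} tl hd r A a =
  (∀ i j → a i ≡ a j → i ≡ j) ×
  (∀ e → e ∈ A → ∃[ i ] a i ≡ e) ×
  (∀ i → a i ∈ A) ×
  (∀ i → Reach tl hd A (tl (a i)) (prevNode r hd a i))

{-# OPTIONS --safe #-}
-- Contracting a₀,…,a_{i-1} in this order only ever merges nodes into the root: by the
-- preorder property the tail of aₗ is r or the head of an earlier a, so when aₗ is
-- contracted its tail already is the root. Hence the contracted graph is G with the
-- heads of a₀,…,a_{i-1} identified with r. As hd ∘ a enumerates the non-root nodes
-- bijectively and b has the same heads, b enumerates B, and b_i,…,b_{k-1} are exactly
-- the edges of B entering surviving nodes. Following a B-path backwards from a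
-- surviving node, its edges stay among these until the path leaves the surviving
-- nodes, which after merging means it is at the root. So b_i,…,b_{k-1} form an
-- arborescence of G_i avoiding aᵢ, and every forced edge of G_i is among them.
module Submission where

open import Defs
open import Data.Nat using (ℕ; suc)
open import Data.Fin using (Fin; _≤_)
open import Data.Fin.Subset using (Subset; _∈_; _∉_)
open import Data.Product using (_×_; ∃-syntax)
open import Relation.Binary.PropositionalEquality using (_≡_; _≢_)

import Data.Nat.Base as ℕ
import Data.Nat.Properties as ℕ
open import Data.Nat.Base using (zero; _+_; z≤n; s≤s)
open import Data.Bool.Base using (_∧_; not)
open import Data.Fin.Base using (zero; suc; toℕ; _<_; punchIn; punchOut; inject₁)
open import Data.Fin.Properties
  using (_≟_; any?; 0≢1+n; suc-injective; punchIn-injective; punchInᵢ≢i; punchOut-injective;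
         injective⇒≤; <-trans; ≤̄⇒inject₁<; toℕ<n)
open import Data.Fin.Induction using (<-wellFounded)
open import Data.Fin.Subset using (inside; outside; _─_; _-_; ⁅_⁆; ∣_∣; ⊤)
open import Data.Fin.Subset.Properties
  using (_∈?_; ∈⊤; ∣⊤∣≡n; p─⊥≡p; p─q⊆p; x∉⁅y⁆⇒x≢y; x∈p∧x≢y⇒x∈p-y)
open import Data.List.Base using (take)
import Data.List.Base as List
open import Data.Vec.Base using (_∷_; here; there; lookup)
open import Data.Vec.Properties using ([]=⇒lookup; lookup⇒[]=; lookup∘tabulate)
open import Data.Product using (_,_; proj₁; proj₂)
open import Data.Sum using (_⊎_; inj₁; inj₂)
open import Function.Base using (_∘_)
open import Function.Definitions using (Injective)
open import Induction.WellFounded using (module All)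
open import Relation.Binary.PropositionalEquality
  using (refl; sym; trans; cong; cong₂; cong-app; subst; subst₂; module ≡-Reasoning)
open import Relation.Nullary using (yes; no; contradiction)
open import Relation.Nullary.Decidable using (⌊_⌋; isYes≗does; dec-false)

x∈p─q⇒x∉q : ∀ {n} (p q : Subset n) {x} → x ∈ p ─ q → x ∉ q
x∈p─q⇒x∉q (_ ∷ p) (outside ∷ q) here        ()
x∈p─q⇒x∉q (_ ∷ p) (_       ∷ q) (there x∈) (there x∈q) = x∈p─q⇒x∉q p q x∈ x∈q

x∈p-y⇒x≢y : ∀ {n} (p : Subset n) {x y} → x ∈ p - y → x ≢ y
x∈p-y⇒x≢y p {y = y} = x∉⁅y⁆⇒x≢y ∘ x∈p─q⇒x∉q p ⁅ y ⁆

suc∣p-x∣≡∣p∣ : ∀ {n} (p : Subset n) {x} → x ∈ p → suc ∣ p - x ∣ ≡ ∣ p ∣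
suc∣p-x∣≡∣p∣ (inside  ∷ p) here        = cong (suc ∘ ∣_∣) (p─⊥≡p p)
suc∣p-x∣≡∣p∣ (inside  ∷ p) (there x∈p) = cong suc (suc∣p-x∣≡∣p∣ p x∈p)
suc∣p-x∣≡∣p∣ (outside ∷ p) (there x∈p) = suc∣p-x∣≡∣p∣ p x∈p

injective⇒surjective : ∀ {k} (f : Fin k → Fin k) → Injective _≡_ _≡_ f → ∀ y → ∃[ x ] f x ≡ y
injective⇒surjective {suc k} f f-injective y with any? (λ x → f x ≟ y)
... | yes found = found
... | no missed = contradiction (injective⇒≤ punchOut∘f-injective) ℕ.1+n≰n
  where
  y≢f : ∀ x → y ≢ f x
  y≢f x y≡fx = missed (x , sym y≡fx)

  punchOut∘f-injective : Injective _≡_ _≡_ (λ x → punchOut (y≢f x))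
  punchOut∘f-injective = f-injective ∘ punchOut-injective (y≢f _) (y≢f _)

-- Choosing preimages of the k values other than r gives an injection, hence a
-- bijection, Fin k → Fin k; so every index is a chosen preimage.
module _ {k} {f : Fin k → Fin (suc k)} {r : Fin (suc k)}
         (onto : ∀ v → v ≢ r → ∃[ j ] f j ≡ v) where

  private
    preimage : Fin k → Fin k
    preimage x = proj₁ (onto (punchIn r x) (punchInᵢ≢i r x))

    f∘preimage : ∀ x → f (preimage x) ≡ punchIn r x
    f∘preimage x = proj₂ (onto (punchIn r x) (punchInᵢ≢i r x))

    preimage-injective : Injective _≡_ _≡_ preimage
    preimage-injective {x} {y} eq =
      punchIn-injective r x y (trans (sym (f∘preimage x)) (trans (cong f eq) (f∘preimage y)))

    preimage-surjective : ∀ j → ∃[ x ] preimage x ≡ j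
    preimage-surjective = injective⇒surjective preimage preimage-injective

  ontoAllBut⇒avoids : ∀ j → f j ≢ r
  ontoAllBut⇒avoids j with preimage-surjective j
  ... | x , refl = punchInᵢ≢i r x ∘ trans (sym (f∘preimage x))

  ontoAllBut⇒injective : Injective _≡_ _≡_ f
  ontoAllBut⇒injective {i} {j} fi≡fj with preimage-surjective i | preimage-surjective j
  ... | x , refl | y , refl =
    cong preimage (punchIn-injective r x y
      (trans (sym (f∘preimage x)) (trans fi≡fj (f∘preimage y))))

-- The recursion follows contractAll H (take ℓ (List.tabulate f)), so that
-- nodes-contractFirst below holds definitionally.
removeFirst : ∀ {n k} → ℕ → (Fin k → Fin n) → Subset n → Subset n
removeFirst             zero    f p = p
removeFirst {k = zero}  (suc ℓ) f p = p
removeFirst {k = suc k} (suc ℓ) f p = removeFirst ℓ (f ∘ suc) (p - f zero)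

module _ {n : ℕ} where

  ∈-removeFirst⁻ : ∀ ℓ {k} (f : Fin k → Fin n) {p x} → x ∈ removeFirst ℓ f p →
                   x ∈ p × (∀ l → toℕ l ℕ.< ℓ → f l ≢ x)
  ∈-removeFirst⁻ zero            f x∈ = x∈ , λ _ ()
  ∈-removeFirst⁻ (suc ℓ) {zero}  f x∈ = x∈ , λ ()
  ∈-removeFirst⁻ (suc ℓ) {suc k} f {p} x∈ with ∈-removeFirst⁻ ℓ (f ∘ suc) x∈
  ... | x∈p-f₀ , kept = p─q⊆p p _ x∈p-f₀ , λ
    { zero    _         f₀≡x → x∈p-y⇒x≢y p x∈p-f₀ (sym f₀≡x)
    ; (suc l) (s≤s l<ℓ) → kept l l<ℓ }

  ∈-removeFirst⁺ : ∀ ℓ {k} (f : Fin k → Fin n) {p x} → x ∈ p →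
                   (∀ l → toℕ l ℕ.< ℓ → f l ≢ x) → x ∈ removeFirst ℓ f p
  ∈-removeFirst⁺ zero            f x∈p _    = x∈p
  ∈-removeFirst⁺ (suc ℓ) {zero}  f x∈p _    = x∈p
  ∈-removeFirst⁺ (suc ℓ) {suc k} f x∈p kept =
    ∈-removeFirst⁺ ℓ (f ∘ suc) (x∈p∧x≢y⇒x∈p-y x∈p (kept zero (s≤s z≤n) ∘ sym))
      (λ l → kept (suc l) ∘ s≤s)

  ∣removeFirst∣ : ∀ ℓ {k} {f : Fin k → Fin n} {p} → ℓ ℕ.≤ k → Injective _≡_ _≡_ f →
                  (∀ l → f l ∈ p) → ∣ removeFirst ℓ f p ∣ + ℓ ≡ ∣ p ∣
  ∣removeFirst∣ zero            _         _           _   = ℕ.+-identityʳ _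
  ∣removeFirst∣ (suc ℓ) {suc k} {f} {p} (s≤s ℓ≤k) f-injective f∈p = begin
    ∣ rest ∣ + suc ℓ    ≡⟨ ℕ.+-suc ∣ rest ∣ ℓ ⟩
    suc (∣ rest ∣ + ℓ)  ≡⟨ cong suc (∣removeFirst∣ ℓ ℓ≤k (suc-injective ∘ f-injective) f∘suc∈) ⟩
    suc ∣ p - f zero ∣  ≡⟨ suc∣p-x∣≡∣p∣ p (f∈p zero) ⟩
    ∣ p ∣               ∎
    where
    open ≡-Reasoning
    rest : Subset n
    rest = removeFirst ℓ (f ∘ suc) (p - f zero)

    f∘suc∈ : ∀ l → f (suc l) ∈ p - f zero
    f∘suc∈ l = x∈p∧x≢y⇒x∈p-y (f∈p (suc l)) (0≢1+n ∘ sym ∘ f-injective)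

  module _ {k} {f : Fin k → Fin n} (f-injective : Injective _≡_ _≡_ f) where

    image∈removeFirst⁻ : ∀ ℓ {p j} → f j ∈ removeFirst ℓ f p → ℓ ℕ.≤ toℕ j
    image∈removeFirst⁻ ℓ fj∈ = ℕ.≮⇒≥ (λ j<ℓ → proj₂ (∈-removeFirst⁻ ℓ f fj∈) _ j<ℓ refl)

    image∈removeFirst⁺ : ∀ ℓ {p j} → f j ∈ p → ℓ ℕ.≤ toℕ j → f j ∈ removeFirst ℓ f p
    image∈removeFirst⁺ ℓ fj∈p ℓ≤j = ∈-removeFirst⁺ ℓ f fj∈p λ l l<ℓ fl≡fj →
      ℕ.<-irrefl (cong toℕ (f-injective fl≡fj)) (ℕ.<-≤-trans l<ℓ ℓ≤j)

    injective⇒onto : ∀ {p} → (∀ l → f l ∈ p) → ∣ p ∣ ≡ k → ∀ {x} → x ∈ p → ∃[ l ] f l ≡ x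
    injective⇒onto {p} f∈p ∣p∣≡k {x} x∈p with any? (λ l → f l ≟ x)
    ... | yes found = found
    ... | no missed = contradiction (trans (suc∣p-x∣≡∣p∣ rest x∈rest) ∣rest∣≡0) λ ()
      where
      rest : Subset n
      rest = removeFirst k f p

      x∈rest : x ∈ rest
      x∈rest = ∈-removeFirst⁺ k f x∈p (λ l _ fl≡x → missed (l , fl≡x))

      ∣rest∣≡0 : ∣ rest ∣ ≡ 0
      ∣rest∣≡0 = ℕ.+-cancelʳ-≡ k _ 0 (trans (∣removeFirst∣ k ℕ.≤-refl f-injective f∈p) ∣p∣≡k)

module _ {n m : ℕ} where

  reach-lastEdge : ∀ {tl hd : Fin m → Fin n} {T x v} → Reach tl hd T x v → v ≢ x →
                   ∃[ e ] (e ∈ T × hd e ≡ v)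
  reach-lastEdge here                 v≢x = contradiction refl v≢x
  reach-lastEdge (step {e = e} _ e∈T _) _ = e , e∈T , refl

  spanning⇒heads-onto : ∀ {tl hd : Fin m → Fin n} {T x k} {f : Fin k → Fin m} →
                        (∀ v → Reach tl hd T x v) → (∀ {e} → e ∈ T → ∃[ j ] f j ≡ e) →
                        ∀ v → v ≢ x → ∃[ j ] hd (f j) ≡ v
  spanning⇒heads-onto spans f-onto v v≢x with reach-lastEdge (spans v) v≢x
  ... | _ , e∈T , hd≡v with f-onto e∈T
  ...   | j , refl = j , hd≡v

  arborescence-deleteEdge : ∀ {H : RGraph n m} {T e} → Arborescence H T → e ∉ T →
                            Arborescence (deleteEdge H e) T
  arborescence-deleteEdge (T⊆ , size , spans) e∉T =
    (λ f∈T → x∈p∧x≢y⇒x∈p-y (T⊆ f∈T) λ { refl → e∉T f∈T }) , size , spans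

  nodes-contractFirst : ∀ ℓ {k} (f : Fin k → Fin m) (H : RGraph n m) →
                        nodes (contractAll H (take ℓ (List.tabulate f)))
                          ≡ removeFirst ℓ (hd H ∘ f) (nodes H)
  nodes-contractFirst zero            f H = refl
  nodes-contractFirst (suc ℓ) {zero}  f H = refl
  nodes-contractFirst (suc ℓ) {suc k} f H = nodes-contractFirst ℓ (f ∘ suc) (contract H (f zero))

-- H is the graph with tails tl₀, heads hd₀ and root r in which every node outside
-- nodes H has been identified with the root; edges entering those nodes may or
-- may not survive.
record MergedIntoRoot {n m} (tl₀ hd₀ : Fin m → Fin n) (r : Fin n) (H : RGraph n m) : Set where
  field
    hd-eq        : hd H ≡ hd₀
    root-eq      : root H ≡ r
    edge-present : ∀ {e} → hd₀ e ∈ nodes H → e ∈ edges H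
    tl-kept      : ∀ {e} → tl₀ e ∈ nodes H → tl H e ≡ tl₀ e
    tl-merged    : ∀ {e} → tl₀ e ∉ nodes H → tl H e ≡ r

module _ {n m} {tl₀ hd₀ : Fin m → Fin n} {r : Fin n} where

  fullGraph-merged : MergedIntoRoot tl₀ hd₀ r (fullGraph tl₀ hd₀ r)
  fullGraph-merged = record
    { hd-eq = refl ; root-eq = refl ; edge-present = λ _ → ∈⊤
    ; tl-kept = λ _ → refl ; tl-merged = contradiction ∈⊤ }

  merged-tl≡root : ∀ {H e} → MergedIntoRoot tl₀ hd₀ r H → (tl₀ e ∈ nodes H → tl₀ e ≡ r) →
                   tl H e ≡ r
  merged-tl≡root {H} {e} M tl₀≡r with tl₀ e ∈? nodes H
  ... | yes tl₀∈ = trans (MergedIntoRoot.tl-kept M tl₀∈) (tl₀≡r tl₀∈)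
  ... | no  tl₀∉ = MergedIntoRoot.tl-merged M tl₀∉

  contract-merged : ∀ {H e} → MergedIntoRoot tl₀ hd₀ r H → tl H e ≡ r →
                    MergedIntoRoot tl₀ hd₀ r (contract H e)
  contract-merged {H} {e} M u≡r = record
    { hd-eq = hd-eq ; root-eq = root-eq ; edge-present = edge-present′
    ; tl-kept = tl-kept′ ; tl-merged = tl-merged′ }
    where
    open MergedIntoRoot M
    v : Fin n
    v = hd H e

    edge-present′ : ∀ {f} → hd₀ f ∈ nodes H - v → f ∈ edges (contract H e)
    edge-present′ {f} hd₀f∈ = lookup⇒[]= f _ (begin
      lookup (edges (contract H e)) f           ≡⟨ lookup∘tabulate _ f ⟩
      lookup (edges H) f ∧ not ⌊ hd H f ≟ v ⌋  ≡⟨ cong₂ _∧_ f∈edges (cong not hd-f≢v) ⟩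
      inside                                     ∎)
      where
      open ≡-Reasoning
      f∈edges : lookup (edges H) f ≡ inside
      f∈edges = []=⇒lookup (edge-present (p─q⊆p _ _ hd₀f∈))
      hd-f≢v : ⌊ hd H f ≟ v ⌋ ≡ outside
      hd-f≢v = trans (isYes≗does (hd H f ≟ v))
        (dec-false (hd H f ≟ v) (x∈p-y⇒x≢y _ hd₀f∈ ∘ trans (sym (cong-app hd-eq f))))

    tl-kept′ : ∀ {f} → tl₀ f ∈ nodes H - v → tl (contract H e) f ≡ tl₀ f
    tl-kept′ {f} tl₀f∈ with tl H f ≟ v
    ... | yes tl≡v =
      contradiction (trans (sym (tl-kept (p─q⊆p _ _ tl₀f∈))) tl≡v) (x∈p-y⇒x≢y _ tl₀f∈)
    ... | no  _    = tl-kept (p─q⊆p _ _ tl₀f∈)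

    tl-merged′ : ∀ {f} → tl₀ f ∉ nodes H - v → tl (contract H e) f ≡ r
    tl-merged′ {f} tl₀f∉ with tl H f ≟ v | tl₀ f ∈? nodes H
    ... | yes _   | _          = u≡r
    ... | no  _   | no  tl₀∉H = tl-merged tl₀∉H
    ... | no  tl≢v | yes tl₀∈H =
      contradiction (x∈p∧x≢y⇒x∈p-y tl₀∈H (tl≢v ∘ trans (tl-kept tl₀∈H))) tl₀f∉

  contractFirst-merged : ∀ ℓ {k} (f : Fin k → Fin m) {H} → MergedIntoRoot tl₀ hd₀ r H →
                         (∀ l → tl₀ (f l) ∈ removeFirst (toℕ l) (hd H ∘ f) (nodes H) →
                                tl₀ (f l) ≡ r) →
                         MergedIntoRoot tl₀ hd₀ r (contractAll H (take ℓ (List.tabulate f)))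
  contractFirst-merged zero            f M _ = M
  contractFirst-merged (suc ℓ) {zero}  f M _ = M
  contractFirst-merged (suc ℓ) {suc k} f M tails-merged =
    contractFirst-merged ℓ (f ∘ suc) (contract-merged M (merged-tl≡root M (tails-merged zero)))
      (tails-merged ∘ suc)

  reach-merged : ∀ {H B T} → MergedIntoRoot tl₀ hd₀ r H →
                 (∀ {e} → e ∈ B → hd₀ e ∈ nodes H → e ∈ T) →
                 ∀ {w} → Reach tl₀ hd₀ B r w → w ∈ nodes H → Reach (tl H) (hd H) T (root H) w
  reach-merged {H} {B} {T} M B∩H⊆T {w} B-path w∈H =
    subst₂ (λ h x → Reach (tl H) h T x w) (sym hd-eq) (sym root-eq) (go B-path w∈H)
    where
    open MergedIntoRoot M
    go : ∀ {w} → Reach tl₀ hd₀ B r w → w ∈ nodes H → Reach (tl H) hd₀ T r w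
    go here                        _     = here
    go (step {e = e} path e∈B refl) hd∈H = step tl-path (B∩H⊆T e∈B hd∈H) refl
      where
      tl-path : Reach (tl H) hd₀ T r (tl H e)
      tl-path with tl₀ e ∈? nodes H
      ... | yes tl∈H = subst (Reach (tl H) hd₀ T r) (sym (tl-kept tl∈H)) (go path tl∈H)
      ... | no  tl∉H = subst (Reach (tl H) hd₀ T r) (sym (tl-merged tl∉H)) here

module PreorderEnumeration
  {n m k} {tl hd : Fin m → Fin n} {r : Fin n} {A : Subset m} {a : Fin (suc k) → Fin m}
  (hd∘a-injective : Injective _≡_ _≡_ (hd ∘ a))
  (hd∘a≢r : ∀ j → hd (a j) ≢ r)
  (a-onto : ∀ {e} → e ∈ A → ∃[ j ] a j ≡ e)
  (preorder : ∀ j → Reach tl hd A (tl (a j)) (prevNode r hd a j))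
  where

  Earlier : Fin (suc k) → Fin n → Set
  Earlier j x = x ≡ r ⊎ ∃[ l ] (l < j × x ≡ hd (a l))

  earlier-mono : ∀ {l j x} → l < j → Earlier l x → Earlier j x
  earlier-mono _   (inj₁ x≡r)               = inj₁ x≡r
  earlier-mono l<j (inj₂ (i , i<l , x≡hd)) = inj₂ (i , <-trans i<l l<j , x≡hd)

  prevNode-earlier : ∀ j → Earlier j (prevNode r hd a j)
  prevNode-earlier zero    = inj₁ refl
  prevNode-earlier (suc j) = inj₂ (inject₁ j , ≤̄⇒inject₁< ℕ.≤-refl , refl)

  earlier-backwards : ∀ {j x y} → (∀ {l} → l < j → Earlier l (tl (a l))) →
                      Reach tl hd A x y → Earlier j y → Earlier j x
  earlier-backwards IH here y-earlier = y-earlier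
  earlier-backwards IH (step path e∈A refl) y-earlier with a-onto e∈A
  ... | l , refl with y-earlier
  ...   | inj₁ hd≡r = contradiction hd≡r (hd∘a≢r l)
  ...   | inj₂ (l′ , l′<j , hd≡hd) with hd∘a-injective hd≡hd
  ...     | refl = earlier-backwards IH path (earlier-mono l′<j (IH l′<j))

  tl-earlier : ∀ j → Earlier j (tl (a j))
  tl-earlier = All.wfRec <-wellFounded _ (λ j → Earlier j (tl (a j)))
    λ j IH → earlier-backwards IH (preorder j) (prevNode-earlier j)

  surviving-tl≡r : ∀ {p} l → tl (a l) ∈ removeFirst (toℕ l) (hd ∘ a) p → tl (a l) ≡ r
  surviving-tl≡r l tl∈ with tl-earlier l
  ... | inj₁ tl≡r                = tl≡r
  ... | inj₂ (l′ , l′<l , tl≡hd) =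
    contradiction (sym tl≡hd) (proj₂ (∈-removeFirst⁻ (toℕ l) (hd ∘ a) tl∈) l′ l′<l)

module RemainingArborescence
  {k m} {tl₀ hd₀ : Fin m → Fin (suc k)} {r : Fin (suc k)} {B : Subset m} {a b : Fin k → Fin m}
  (hd∘a-injective : Injective _≡_ _≡_ (hd₀ ∘ a))
  (b-matches : ∀ j → b j ∈ B × hd₀ (b j) ≡ hd₀ (a j))
  (B-arborescence : Arborescence (fullGraph tl₀ hd₀ r) B)
  where

  b∈B : ∀ j → b j ∈ B
  b∈B = proj₁ ∘ b-matches

  b-injective : Injective _≡_ _≡_ b
  b-injective {i} {j} bi≡bj =
    hd∘a-injective (trans (sym (proj₂ (b-matches i)))
                          (trans (cong hd₀ bi≡bj) (proj₂ (b-matches j))))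

  ∣B∣≡k : ∣ B ∣ ≡ k
  ∣B∣≡k = ℕ.suc-injective (trans (proj₁ (proj₂ B-arborescence)) (∣⊤∣≡n (suc k)))

  b-onto : ∀ {e} → e ∈ B → ∃[ j ] b j ≡ e
  b-onto = injective⇒onto b-injective b∈B ∣B∣≡k

  remaining-late : ∀ ℓ {e} → e ∈ removeFirst ℓ b B → ∃[ j ] (ℓ ℕ.≤ toℕ j × e ≡ b j)
  remaining-late ℓ e∈ with b-onto (proj₁ (∈-removeFirst⁻ ℓ b e∈))
  ... | j , refl = j , image∈removeFirst⁻ b-injective ℓ e∈ , refl

  module _ {ℓ H} (M : MergedIntoRoot tl₀ hd₀ r H)
           (nodes-H : nodes H ≡ removeFirst ℓ (hd₀ ∘ a) ⊤) where

    private
      head-survives⁻ : ∀ j → hd₀ (b j) ∈ nodes H → ℓ ℕ.≤ toℕ j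
      head-survives⁻ j hd∈H = image∈removeFirst⁻ hd∘a-injective ℓ
        (subst₂ _∈_ (proj₂ (b-matches j)) nodes-H hd∈H)

      head-survives⁺ : ∀ j → ℓ ℕ.≤ toℕ j → hd₀ (b j) ∈ nodes H
      head-survives⁺ j ℓ≤j = subst₂ _∈_ (sym (proj₂ (b-matches j))) (sym nodes-H)
        (image∈removeFirst⁺ hd∘a-injective ℓ ∈⊤ ℓ≤j)

    remaining-arborescence : ℓ ℕ.≤ k → Arborescence H (removeFirst ℓ b B)
    remaining-arborescence ℓ≤k = T⊆edges , size , spans
      where
      open MergedIntoRoot M
      T : Subset m
      T = removeFirst ℓ b B

      T⊆edges : ∀ {e} → e ∈ T → e ∈ edges H
      T⊆edges e∈T with remaining-late ℓ e∈T
      ... | j , ℓ≤j , refl = edge-present (head-survives⁺ j ℓ≤j)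

      ∣T∣+ℓ : ∣ T ∣ + ℓ ≡ k
      ∣T∣+ℓ = trans (∣removeFirst∣ ℓ ℓ≤k b-injective b∈B) ∣B∣≡k

      size : suc ∣ T ∣ ≡ ∣ nodes H ∣
      size = ℕ.+-cancelʳ-≡ ℓ _ _ (trans (cong suc ∣T∣+ℓ) (sym ∣nodes∣+ℓ))
        where
        ∣nodes∣+ℓ : ∣ nodes H ∣ + ℓ ≡ suc k
        ∣nodes∣+ℓ = subst (λ p → ∣ p ∣ + ℓ ≡ suc k) (sym nodes-H)
          (trans (∣removeFirst∣ ℓ ℓ≤k hd∘a-injective (λ _ → ∈⊤)) (∣⊤∣≡n (suc k)))

      B∩H⊆T : ∀ {e} → e ∈ B → hd₀ e ∈ nodes H → e ∈ T
      B∩H⊆T e∈B hd∈H with b-onto e∈B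
      ... | j , refl = image∈removeFirst⁺ b-injective ℓ (b∈B j) (head-survives⁻ j hd∈H)

      spans : ∀ v → v ∈ nodes H → Reach (tl H) (hd H) T (root H) v
      spans v = reach-merged M B∩H⊆T (proj₂ (proj₂ B-arborescence) v ∈⊤)

lemma9 : (k m : ℕ) (tl hd : Fin m → Fin (suc k)) (r : Fin (suc k))
    → (∀ e → tl e ≢ hd e)
    → (A B : Subset m)
    → Arborescence (fullGraph tl hd r) A
    → Arborescence (fullGraph tl hd r) B
    → (∀ e → e ∈ A → e ∉ B)
    → (a b : Fin k → Fin m)
    → IsPreorderEnum tl hd r A a
    → (∀ i → b i ∈ B × hd (b i) ≡ hd (a i))
    → (i : Fin k) (e : Fin m)
    → Forced (Gi (fullGraph tl hd r) a i) e
    → ∃[ j ] (i ≤ j × e ≡ b j)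
lemma9 (suc k) m tl hd r _ A B (_ , _ , A-spans) B-arborescence disjoint a b
       (_ , a-onto , a∈A , a-preorder) b-matches i e (_ , forced) =
  remaining-late ℓ (forced T T-arborescence)
  where
  ℓ : ℕ
  ℓ = toℕ i

  T : Subset m
  T = removeFirst ℓ b B

  heads-onto : ∀ v → v ≢ r → ∃[ j ] hd (a j) ≡ v
  heads-onto = spanning⇒heads-onto (λ v → A-spans v ∈⊤) (a-onto _)

  hd∘a-injective : Injective _≡_ _≡_ (hd ∘ a)
  hd∘a-injective = ontoAllBut⇒injective heads-onto

  open PreorderEnumeration hd∘a-injective (ontoAllBut⇒avoids heads-onto) (a-onto _) a-preorder
  open RemainingArborescence hd∘a-injective b-matches B-arborescence

  T-arborescence : Arborescence (Gi (fullGraph tl hd r) a i) T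
  T-arborescence = arborescence-deleteEdge
    (remaining-arborescence (contractFirst-merged ℓ a fullGraph-merged surviving-tl≡r)
      (nodes-contractFirst ℓ a (fullGraph tl hd r)) (ℕ.<⇒≤ (toℕ<n i)))
    (λ aᵢ∈T → disjoint (a i) (a∈A i) (proj₁ (∈-removeFirst⁻ ℓ b aᵢ∈T)))
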